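{- Let $R$ be a connected digraph. Then $R$ is walk-Helly if and only if there exists a tree representation of $R$.
   Context: A digraph is connected if its underlying undirected graph is connected. A closed walk of a digraph is a sequence $(u_0,\dots,u_k)$, $k\ge1$, with $(u_i,u_{i+1})$ an arc for all $i$ and $u_k=u_0$. A tree representation of $R=(V,A)$ is a tree $T$ on vertex set $V$ such that the induced subgraph $T[S]$ is connected for the vertex set $S$ of every closed walk of $R$. A family of sets has the Helly property if every subfamily of pairwise intersecting sets has a common element. $R$ is walk-Helly if the family of vertex sets of closed walks of $R$ has the Helly property, i.e. any set of pairwise non-vertex-disjoint closed walks all share a common vertex. -}

module Defs where

open import Data.Nat using (ℕ; suc)
open import Data.Fin using (Fin)
open import Data.Bool using (Bool; true)
open import Data.List using (List; []; _∷_; _++_)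
open import Data.List.Relation.Unary.Unique.Propositional using (Unique)
open import Data.List.Membership.Propositional using (_∈_)
open import Data.List.Relation.Unary.All using (All)
open import Data.Product using (Σ; ∃; ∃-syntax; _×_)
open import Data.Sum using (_⊎_)
open import Data.Unit using (⊤)
open import Data.Empty using (⊥)
open import Relation.Binary.PropositionalEquality using (_≡_)

Digraph : ℕ → Set
Digraph n = Fin (suc n) → Fin (suc n) → Bool

-- Likewise an (undirected, simple) graph on Fin (suc n) is given by an
-- edge relation; the tree axioms below require it to be symmetric and
-- irreflexive.
Graph : ℕ → Set
Graph n = Fin (suc n) → Fin (suc n) → Bool

module _ {n : ℕ} where
  V : Set
  V = Fin (suc n)

  data WalkWithin (E : V → V → Set) (S : V → Set) : V → V → Set where
    here  : ∀ {u} → S u → WalkWithin E S u u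
    step  : ∀ {u v w} → S u → E u v → WalkWithin E S v w → WalkWithin E S u w

  UAdj : Digraph n → V → V → Set
  UAdj R u v = (R u v ≡ true) ⊎ (R v u ≡ true)

  ConnectedDigraph : Digraph n → Set
  ConnectedDigraph R = ∀ u v → WalkWithin (UAdj R) (λ _ → ⊤) u v

  Edge : Graph n → V → V → Set
  Edge T u v = T u v ≡ true

  InducedConnected : Graph n → (V → Set) → Set
  InducedConnected T S = ∀ u v → S u → S v → WalkWithin (Edge T) S u v

  IsPath : Graph n → List V → Set
  IsPath T []            = ⊤
  IsPath T (x ∷ [])      = ⊤
  IsPath T (x ∷ y ∷ xs)  = Edge T x y × IsPath T (y ∷ xs)

  Cycle : Graph n → Set
  Cycle T = Σ V λ x → Σ V λ y → Σ V λ z → Σ (List V) λ rest →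
            Unique (x ∷ y ∷ z ∷ rest) × IsPath T (x ∷ y ∷ z ∷ rest ++ x ∷ [])

  IsTree : Graph n → Set
  IsTree T = (∀ u v → Edge T u v → Edge T v u)
           × (∀ u → Edge T u u → ⊥)
           × (∀ u v → WalkWithin (Edge T) (λ _ → ⊤) u v)
           × (Cycle T → ⊥)

  data DWalk (R : Digraph n) : V → V → Set where
    []  : ∀ {u} → DWalk R u u
    _∷_ : ∀ {u v w} → R u v ≡ true → DWalk R v w → DWalk R u w

  data OnWalk {R : Digraph n} (x : V) : ∀ {u w} → DWalk R u w → Set where
    now   : ∀ {u w} {p : DWalk R u w} → x ≡ u → OnWalk x p
    later : ∀ {u v w} {a : R u v ≡ true} {p : DWalk R v w} →
            OnWalk x p → OnWalk x (a ∷ p)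

  -- A closed walk (u_0, u_1, ..., u_k) with k ≥ 1 and u_k = u_0:
  -- a first arc (u_0 , u_1) followed by a walk from u_1 back to u_0.
  record ClosedWalk (R : Digraph n) : Set where
    constructor closedWalk
    field
      base  : V
      next  : V
      arc   : R base next ≡ true
      back  : DWalk R next base

  VerticesOf : {R : Digraph n} → ClosedWalk R → V → Set
  VerticesOf (closedWalk b nx a p) x = OnWalk x (a ∷ p)

  Meet : {R : Digraph n} → ClosedWalk R → ClosedWalk R → Set
  Meet c d = ∃[ x ] (VerticesOf c x × VerticesOf d x)

  WalkHelly : Digraph n → Set
  WalkHelly R = (F : List (ClosedWalk R)) →
                (∀ c d → c ∈ F → d ∈ F → Meet c d) →
                ∃[ x ] All (λ c → VerticesOf c x) F

  TreeRepresentation : Digraph n → Set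
  TreeRepresentation R = Σ (Graph n) λ T →
    IsTree T × ((c : ClosedWalk R) → InducedConnected T (VerticesOf c))

{-# OPTIONS --safe #-}
-- Both directions pass through rankings of the family of closed walks: a root, ranks, and parents
-- of higher rank, such that a closed walk through x and through another vertex of rank at least
-- rank x also passes through the parent of x. In the parent tree of a ranking every closed walk is
-- connected (climb to its highest vertex), and closed walks are Helly (climb, inside both walks,
-- towards the top of the walk whose top is lowest).
--
-- Rankings are built by removing leaves: a leaf v attached at u is a vertex such that each closed
-- walk through v and another remaining vertex passes through u. Given a tree representation, the
-- pendant vertices of the remaining subtree are leaves. In a walk-Helly digraph there is a leaf
-- other than any given vertex a: either no two vertices are strongly connected in R − a, and every
-- vertex is a leaf attached at a, or the strong component B of R − a of such a pair is again Helly,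
-- the Helly property yields some β ∈ B on every closed walk between B and the rest, and a leaf of B
-- other than β is a leaf of the whole vertex set.
module Submission where

open import Defs
open import Data.Nat using (ℕ; suc; _≤_; _<_; _∸_; z≤n; s≤s)
import Data.Nat.Properties as ℕ
open import Data.Nat.Induction using (<-wellFounded)
open import Data.Fin using (Fin; zero; _≟_)
open import Data.Fin.Properties using (any?)
open import Data.Bool using (true; if_then_else_)
import Data.Bool.Properties as Bool
open import Data.List using (List; []; _∷_; _++_; [_]; _∷ʳ_; length; filter; allFin)
open import Data.List.Extrema.Nat
  using (argmin; argmax; argmin-all; argmax-all; f[argmin]≤f[⊤]; f[argmin]≤f[xs]; f[xs]≤f[argmax])
open import Data.List.Membership.Propositional using (_∈_; _∉_; find; lose)
open import Data.List.Membership.Propositional.Properties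
  using (∈-filter⁺; ∈-filter⁻; ∈-allFin; ∈-++⁺ˡ; ∈-++⁺ʳ; ∈-∃++)
open import Data.List.Properties using (filter-notAll; ∷-injectiveˡ; ∷ʳ-injectiveʳ)
open import Data.List.Relation.Binary.Subset.Propositional using (_⊆_)
open import Data.List.Relation.Unary.Any as Any using (Any; here; there)
open import Data.List.Relation.Unary.All as All using (All; []; _∷_)
open import Data.List.Relation.Unary.All.Properties
  using (¬All⇒Any¬; ¬Any⇒All¬; all-filter; ++⁻ˡ; ++⁻ʳ; ∷ʳ⁺)
open import Data.List.Relation.Unary.AllPairs as AllPairs using ([]; _∷_)
open import Data.List.Relation.Unary.Unique.Propositional using (Unique)
import Data.List.Relation.Unary.Unique.Propositional.Properties as Unique
open import Data.Product using (Σ; ∃; ∃₂; _×_; _,_; proj₁; proj₂)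
open import Data.Sum using (_⊎_; inj₁; inj₂; swap)
open import Data.Empty using (⊥; ⊥-elim)
open import Data.Unit using (⊤; tt)
open import Function using (id; _∘_; _on_)
open import Induction.WellFounded using (WellFounded; Acc; acc)
open import Relation.Binary.Construct.On as On using ()
open import Relation.Binary.PropositionalEquality using (_≡_; _≢_; refl; sym; trans; cong; subst)
open import Relation.Nullary using (Dec; yes; no; ¬_; ¬?; does; _×-dec_; _⊎-dec_)
open import Relation.Nullary.Decidable using (dec-true; dec-false; map′)
open import Relation.Unary using (Decidable)

module _ {n : ℕ} {E : V {n} → V {n} → Set} where

  mapʷ : ∀ {S S′ : V → Set} → (∀ {x} → S x → S′ x) →
         ∀ {u v} → WalkWithin E S u v → WalkWithin E S′ u v
  mapʷ f (here s)     = here (f s)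
  mapʷ f (step s e p) = step (f s) e (mapʷ f p)

  module _ {S : V {n} → Set} where

    start∈ : ∀ {u v} → WalkWithin E S u v → S u
    start∈ (here s)     = s
    start∈ (step s _ _) = s

    end∈ : ∀ {u v} → WalkWithin E S u v → S v
    end∈ (here s)     = s
    end∈ (step _ _ p) = end∈ p

    infixr 5 _++ʷ_
    _++ʷ_ : ∀ {u v w} → WalkWithin E S u v → WalkWithin E S v w → WalkWithin E S u w
    here _     ++ʷ q = q
    step s e p ++ʷ q = step s e (p ++ʷ q)

    snocʷ : ∀ {u v w} → WalkWithin E S u v → E v w → S w → WalkWithin E S u w
    snocʷ p e s = p ++ʷ step (end∈ p) e (here s)

    reverseʷ : (∀ {a b} → E a b → E b a) → ∀ {u v} → WalkWithin E S u v → WalkWithin E S v u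
    reverseʷ sym (here s)     = here s
    reverseʷ sym (step s e p) = snocʷ (reverseʷ sym p) (sym e) s

  first-visit : ∀ {S : V → Set} (v : V) {a b} → WalkWithin E S a b →
                WalkWithin E (λ x → S x × x ≢ v) a b ⊎
                (a ≡ v ⊎ ∃ λ z → WalkWithin E (λ x → S x × x ≢ v) a z × E z v)
  first-visit v {a} p with a ≟ v
  ... | yes a≡v = inj₂ (inj₁ a≡v)
  first-visit v (here sa)     | no a≢v = inj₁ (here (sa , a≢v))
  first-visit v (step sa e p) | no a≢v with first-visit v p
  ... | inj₁ p′                   = inj₁ (step (sa , a≢v) e p′)
  ... | inj₂ (inj₁ refl)          = inj₂ (inj₂ (_ , here (sa , a≢v) , e))
  ... | inj₂ (inj₂ (z , p′ , zv)) = inj₂ (inj₂ (z , step (sa , a≢v) e p′ , zv))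

does⇒ : ∀ {P : Set} (P? : Dec P) → does P? ≡ true → P
does⇒ (yes p) _ = p
does⇒ (no _) ()

module _ {A : Set} where

  shorter-wellFounded : WellFounded (_<_ on length {A = A})
  shorter-wellFounded = On.wellFounded length <-wellFounded

  unique-rotate : ∀ {x : A} {xs} → Unique (x ∷ xs) → Unique (xs ∷ʳ x)
  unique-rotate (x∉xs ∷ unique) =
    Unique.++⁺ unique ([] ∷ []) λ { (v∈xs , here refl) → All.lookup x∉xs v∈xs refl }

  unique-cut : ∀ xs {z : A} {ys} → Unique (xs ++ z ∷ ys) → Unique (xs ∷ʳ z)
  unique-cut []       _             = [] ∷ []
  unique-cut (x ∷ xs) (x∉ ∷ unique) = ∷ʳ⁺ (++⁻ˡ xs x∉) (All.head (++⁻ʳ xs x∉)) ∷ unique-cut xs unique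

  choose : ∀ {B : Set} {P : A → B → Set} xs → All (λ x → Σ B (P x)) xs →
           Σ (List B) λ ys → (∀ {y} → y ∈ ys → ∃ λ x → x ∈ xs × P x y) ×
                             (∀ {x} → x ∈ xs → ∃ λ y → y ∈ ys × P x y)
  choose []       []                = [] , (λ ()) , (λ ())
  choose (x ∷ xs) ((y , pxy) ∷ all) =
    let ys , from , to = choose xs all in
    y ∷ ys ,
    (λ { (here refl) → x , here refl , pxy
       ; (there y∈)  → let x′ , x′∈ , p = from y∈ in x′ , there x′∈ , p }) ,
    (λ { (here refl) → y , here refl , pxy
       ; (there x∈)  → let y′ , y′∈ , p = to x∈ in y′ , there y′∈ , p })

module _ {n : ℕ} where

  open import Data.List.Membership.DecPropositional (_≟_ {suc n}) public using (_∈?_)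

  infixl 6 _∖_
  _∖_ : List (V {n}) → V → List V
  A ∖ v = filter (λ x → ¬? (x ≟ v)) A

  ∈-∖⁺ : ∀ {A x v} → x ∈ A → x ≢ v → x ∈ A ∖ v
  ∈-∖⁺ = ∈-filter⁺ (λ x → ¬? (x ≟ _))

  ∈-∖⁻ : ∀ A {x v} → x ∈ A ∖ v → x ∈ A × x ≢ v
  ∈-∖⁻ A = ∈-filter⁻ (λ x → ¬? (x ≟ _)) {xs = A}

  ∖-shorter : ∀ {A v} → v ∈ A → length (A ∖ v) < length A
  ∖-shorter {A} v∈A = filter-notAll (λ x → ¬? (x ≟ _)) A (Any.map (λ v≡x x≢v → x≢v (sym v≡x)) v∈A)

module _ {n : ℕ} (G : Graph n) where

  edge? : ∀ x y → Dec (Edge G x y)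
  edge? x y = G x y Bool.≟ true

  path-cut : ∀ xs {z w ys} → IsPath G (xs ++ z ∷ ys) → Edge G z w → IsPath G (xs ∷ʳ z ∷ʳ w)
  path-cut []            _        zw = zw , tt
  path-cut (x ∷ [])      (xz , _) zw = xz , zw , tt
  path-cut (x ∷ x′ ∷ xs) (e , p)  zw = e , path-cut (x′ ∷ xs) p zw

  closing-edge : ∀ a L {x} → IsPath G (a ∷ L ∷ʳ x) → ∃ λ l → l ∈ a ∷ L × Edge G l x
  closing-edge a []      (e , _)    = a , here refl , e
  closing-edge a (b ∷ L) (_ , path) = let l , l∈ , e = closing-edge b L path in l , there l∈ , e

module Reachability {n : ℕ} (G : Graph n) {S : V {n} → Set} (S? : Decidable S) where

  Reach : V {n} → V → Set
  Reach = WalkWithin (Edge G) S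

  Explored : V {n} → List V → Set
  Explored u U = ∀ {x} → x ∉ U → Reach u x

  Closed : List (V {n}) → Set
  Closed U = ∀ {x y} → x ∉ U → S y → Edge G x y → y ∉ U

  Frontier : List (V {n}) → V → Set
  Frontier U y = S y × ∃ λ x → x ∉ U × Edge G x y

  frontier? : ∀ U → Decidable (Frontier U)
  frontier? U y = S? y ×-dec any? (λ x → ¬? (x ∈? U) ×-dec edge? G x y)

  explored-∖ : ∀ {u U y} → Explored u U → Frontier U y → Explored u (U ∖ y)
  explored-∖ {y = y} ex (sy , x , x∉U , xy) {z} z∉U∖y with z ≟ y
  ... | yes refl = snocʷ (ex x∉U) xy sy
  ... | no z≢y   = ex (λ z∈U → z∉U∖y (∈-∖⁺ z∈U z≢y))

  explore : ∀ {u} U → Acc (_<_ on length) U → Explored u U →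
            ∃ λ U′ → U′ ⊆ U × Explored u U′ × Closed U′
  explore U (acc rs) ex with Any.any? (frontier? U) U
  ... | yes any = let y , y∈U , fr = find any
                      U′ , U′⊆U∖y , rest = explore (U ∖ y) (rs (∖-shorter y∈U)) (explored-∖ ex fr)
                  in U′ , proj₁ ∘ ∈-∖⁻ U ∘ U′⊆U∖y , rest
  ... | no none = U , id , ex , λ x∉U sy xy y∈U → none (Any.map (λ { refl → sy , _ , x∉U , xy }) y∈U)

  reach-closed : ∀ {U} → Closed U → ∀ {x y} → x ∉ U → Reach x y → y ∉ U
  reach-closed closed x∉U (here _)     = x∉U
  reach-closed closed x∉U (step _ e p) = reach-closed closed (closed x∉U (start∈ p) e) p

  explored-start : ∀ {u} → S u → Explored u (allFin (suc n) ∖ u)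
  explored-start {u} su {x} x∉U with x ≟ u
  ... | yes refl = here su
  ... | no x≢u   = ⊥-elim (x∉U (∈-∖⁺ (∈-allFin x) x≢u))

  reachable? : ∀ u w → Dec (Reach u w)
  reachable? u w with S? u
  ... | no ¬su = no (¬su ∘ start∈)
  ... | yes su with explore (allFin (suc n) ∖ u) (shorter-wellFounded _) (explored-start su)
  ...   | U , U⊆ , ex , closed with w ∈? U
  ...     | no w∉U  = yes (ex w∉U)
  ...     | yes w∈U = no λ p → reach-closed closed u∉U p w∈U
    where
    u∉U : u ∉ U
    u∉U u∈U = proj₂ (∈-∖⁻ (allFin (suc n)) (U⊆ u∈U)) refl

module Rankings {n : ℕ} {I : Set} (S : I → V {n} → Set) where

  record Ranking (A : List (V {n})) : Set where
    field
      root        : V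
      root∈       : root ∈ A
      rank        : V → ℕ
      parent      : V → V
      rank<root   : ∀ {x} → x ∈ A → x ≢ root → rank x < rank root
      rank<parent : ∀ {x} → x ∈ A → x ≢ root → rank x < rank (parent x)
      parent∈     : ∀ {x} → x ∈ A → x ≢ root → parent x ∈ A
      climb       : ∀ i {x w} → x ∈ A → w ∈ A → S i x → S i w → w ≢ x →
                    rank x ≤ rank w → S i (parent x)

  record Leaf (A : List (V {n})) (v u : V) : Set where
    field
      leaf∈       : v ∈ A
      attach∈     : u ∈ A
      attach≢leaf : u ≢ v
      through     : ∀ i → S i v → ∀ {w} → w ∈ A → w ≢ v → S i w → S i u

  singleton : ∀ {A a} → a ∈ A → (∀ {b} → b ∈ A → b ≡ a) → Ranking A
  singleton {a = a} a∈A only = record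
    { root        = a
    ; root∈       = a∈A
    ; rank        = λ _ → 0
    ; parent      = id
    ; rank<root   = λ x∈A x≢a → ⊥-elim (x≢a (only x∈A))
    ; rank<parent = λ x∈A x≢a → ⊥-elim (x≢a (only x∈A))
    ; parent∈     = λ x∈A x≢a → ⊥-elim (x≢a (only x∈A))
    ; climb       = λ i x∈A w∈A _ _ w≢x _ → ⊥-elim (w≢x (trans (only w∈A) (sym (only x∈A))))
    }

  module Extend {A v u} (leaf : Leaf A v u) (ranking : Ranking (A ∖ v)) where
    open Leaf leaf
    open Ranking ranking

    root≢v : root ≢ v
    root≢v = proj₂ (∈-∖⁻ A root∈)

    rank′ : V → ℕ
    rank′ x = if does (x ≟ v) then 0 else suc (rank x)

    parent′ : V → V
    parent′ x = if does (x ≟ v) then u else parent x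

    rank′-other : ∀ {x} → x ≢ v → rank′ x ≡ suc (rank x)
    rank′-other {x} x≢v rewrite dec-false (x ≟ v) x≢v = refl

    rank′<root : ∀ {x} → x ∈ A → x ≢ root → rank′ x < rank′ root
    rank′<root {x} x∈A x≢root rewrite rank′-other root≢v with x ≟ v
    ... | yes _   = s≤s z≤n
    ... | no x≢v = s≤s (rank<root (∈-∖⁺ x∈A x≢v) x≢root)

    rank′<parent′ : ∀ {x} → x ∈ A → x ≢ root → rank′ x < rank′ (parent′ x)
    rank′<parent′ {x} x∈A x≢root with x ≟ v
    ... | yes refl rewrite rank′-other attach≢leaf = s≤s z≤n
    ... | no x≢v =
      let p∈A∖v = parent∈ (∈-∖⁺ x∈A x≢v) x≢root in
      subst (suc (rank x) <_) (sym (rank′-other (proj₂ (∈-∖⁻ A p∈A∖v))))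
            (s≤s (rank<parent (∈-∖⁺ x∈A x≢v) x≢root))

    parent′∈ : ∀ {x} → x ∈ A → x ≢ root → parent′ x ∈ A
    parent′∈ {x} x∈A x≢root with x ≟ v
    ... | yes refl = attach∈
    ... | no x≢v   = proj₁ (∈-∖⁻ A (parent∈ (∈-∖⁺ x∈A x≢v) x≢root))

    climb′ : ∀ i {x w} → x ∈ A → w ∈ A → S i x → S i w → w ≢ x →
             rank′ x ≤ rank′ w → S i (parent′ x)
    climb′ i {x} {w} x∈A w∈A sx sw w≢x rx≤rw with x ≟ v
    ... | yes refl = through i sx w∈A w≢x sw
    ... | no x≢v with w ≟ v
    ...   | yes refl = ⊥-elim (ℕ.n≮0 rx≤rw)
    ...   | no w≢v   = climb i (∈-∖⁺ x∈A x≢v) (∈-∖⁺ w∈A w≢v) sx sw w≢x (ℕ.≤-pred rx≤rw)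

    extended : Ranking A
    extended = record
      { root        = root
      ; root∈       = proj₁ (∈-∖⁻ A root∈)
      ; rank        = rank′
      ; parent      = parent′
      ; rank<root   = rank′<root
      ; rank<parent = rank′<parent′
      ; parent∈     = parent′∈
      ; climb       = climb′
      }

  ranking-by-leaves :
    (P : List (V {n}) → Set) →
    (∀ {A a b} → P A → a ∈ A → b ∈ A → b ≢ a → ∃₂ λ v u → Leaf A v u × P (A ∖ v)) →
    ∀ {A a} → P A → a ∈ A → Ranking A
  ranking-by-leaves P leaf {A} = go A (shorter-wellFounded A)
    where
    go : ∀ A → Acc (_<_ on length) A → ∀ {a} → P A → a ∈ A → Ranking A
    go A (acc rs) {a} pA a∈A with All.all? (_≟ a) A
    ... | yes only = singleton a∈A (All.lookup only)
    ... | no ¬only =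
      let b , b∈A , b≢a  = find (¬All⇒Any¬ (_≟ a) A ¬only)
          v , u , lf , pA∖v = leaf pA a∈A b∈A b≢a
          open Leaf lf
      in Extend.extended lf (go (A ∖ v) (rs (∖-shorter leaf∈)) pA∖v (∈-∖⁺ attach∈ attach≢leaf))

module ParentTree {n : ℕ} {I : Set} {S : I → V {n} → Set}
                  (ranking : Rankings.Ranking S (allFin (suc n))) where
  open Rankings.Ranking ranking

  ParentEdge : V {n} → V → Set
  ParentEdge a b = a ≢ root × parent a ≡ b

  adjacent? : ∀ a b → Dec (ParentEdge a b ⊎ ParentEdge b a)
  adjacent? a b = (¬? (a ≟ root) ×-dec parent a ≟ b) ⊎-dec (¬? (b ≟ root) ×-dec parent b ≟ a)

  opaque
    tree : Graph n
    tree a b = does (adjacent? a b)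

    edge⁺ : ∀ {a b} → ParentEdge a b ⊎ ParentEdge b a → Edge tree a b
    edge⁺ {a} {b} = dec-true (adjacent? a b)

    edge⁻ : ∀ {a b} → Edge tree a b → ParentEdge a b ⊎ ParentEdge b a
    edge⁻ {a} {b} = does⇒ (adjacent? a b)

  rank-increases : ∀ {a b} → ParentEdge a b → rank a < rank b
  rank-increases {a} (a≢root , refl) = rank<parent (∈-allFin a) a≢root

  edge-up : ∀ {a b} → Edge tree a b → rank a ≤ rank b → parent a ≡ b
  edge-up e ra≤rb with edge⁻ e
  ... | inj₁ (_ , pa≡b) = pa≡b
  ... | inj₂ ba         = ⊥-elim (ℕ.<⇒≱ (rank-increases ba) ra≤rb)

  tree-sym : ∀ {a b} → Edge tree a b → Edge tree b a
  tree-sym = edge⁺ ∘ swap ∘ edge⁻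

  tree-irrefl : ∀ a → Edge tree a a → ⊥
  tree-irrefl a e with edge⁻ e
  ... | inj₁ aa = ℕ.<-irrefl refl (rank-increases aa)
  ... | inj₂ aa = ℕ.<-irrefl refl (rank-increases aa)

  valley : ∀ {a m c} → Edge tree a m → Edge tree m c → rank m ≤ rank a → rank m ≤ rank c → a ≡ c
  valley am mc rm≤ra rm≤rc = trans (sym (edge-up (tree-sym am) rm≤ra)) (edge-up mc rm≤rc)

  min-at-end : ∀ {L m} → IsPath tree L → Unique L → m ∈ L → (∀ {y} → y ∈ L → rank m ≤ rank y) →
               (∃ λ L′ → L ≡ m ∷ L′) ⊎ (∃ λ L′ → L ≡ L′ ∷ʳ m)
  min-at-end {a ∷ L}     _           _             (here refl) _   = inj₁ (L , refl)
  min-at-end {a ∷ b ∷ L} (ab , path) (a∉ ∷ unique) (there m∈L) min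
    with min-at-end path unique m∈L (min ∘ there)
  ... | inj₂ (L′ , eq)      = inj₂ (a ∷ L′ , cong (a ∷_) eq)
  ... | inj₁ ([] , refl)    = inj₂ (a ∷ [] , refl)
  ... | inj₁ (c ∷ _ , refl) =
    ⊥-elim (All.lookup a∉ (there (here refl))
             (valley ab (proj₁ path) (min (here refl)) (min (there (there (here refl))))))

  -- The vertex of minimal rank on a cycle would have both of its cycle neighbours as parent.
  acyclic : Cycle tree → ⊥
  acyclic (x , y , z , rest , unique@(x∉ ∷ y∉ ∷ _) , xy , path) =
    not-at-end (min-at-end path (unique-rotate unique) m∈ (min refl))
    where
    P = y ∷ z ∷ rest ++ [ x ]
    m = argmin rank y (z ∷ rest ++ [ x ])

    m∈ : m ∈ P
    m∈ = argmin-all rank {P = _∈ P} (here refl) (All.tabulate there)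

    min : ∀ {v} → v ≡ m → ∀ {w} → w ∈ P → rank v ≤ rank w
    min refl (here refl) = f[argmin]≤f[⊤] {f = rank} y (z ∷ rest ++ [ x ])
    min refl (there w∈)  = All.lookup (f[argmin]≤f[xs] {f = rank} y (z ∷ rest ++ [ x ])) w∈

    not-at-end : (∃ λ L′ → P ≡ m ∷ L′) ⊎ (∃ λ L′ → P ≡ L′ ∷ʳ m) → ⊥
    not-at-end (inj₁ (_ , eq)) =
      let y≡m = ∷-injectiveˡ eq in
      All.lookup x∉ (there (here refl))
        (valley xy (proj₁ path) (min y≡m (there (∈-++⁺ʳ (z ∷ rest) (here refl))))
                                (min y≡m (there (here refl))))
    not-at-end (inj₂ (L′ , eq)) =
      let x≡m = ∷ʳ-injectiveʳ (y ∷ z ∷ rest) L′ eq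
          l , l∈ , lx = closing-edge tree z rest (proj₂ path) in
      All.lookup y∉ l∈ (sym (valley lx xy (min x≡m (there (∈-++⁺ˡ l∈))) (min x≡m (here refl))))

  below≢root : ∀ {x t} → rank x ≤ rank t → x ≢ t → x ≢ root
  below≢root {t = t} rx≤rt x≢t refl =
    ℕ.<⇒≱ (rank<root (∈-allFin t) (λ t≡root → x≢t (sym t≡root))) rx≤rt

  ascend : (Q : V {n} → Set) (t : V) → (∀ {x} → Q x → rank x ≤ rank t) →
           (∀ {x} → Q x → x ≢ t → Q (parent x)) → ∀ {x} → Q x → WalkWithin (Edge tree) Q x t
  ascend Q t bounded up qx = go (On.wellFounded (λ y → rank t ∸ rank y) <-wellFounded _) qx
    where
    go : ∀ {x} → Acc (_<_ on λ y → rank t ∸ rank y) x → Q x → WalkWithin (Edge tree) Q x t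
    go {x} (acc rs) qx with x ≟ t
    ... | yes refl = here qx
    ... | no x≢t   =
      let x≢root = below≢root (bounded qx) x≢t
          qp     = up qx x≢t
      in step qx (edge⁺ (inj₁ (x≢root , refl)))
              (go (rs (ℕ.∸-monoʳ-< (rank<parent (∈-allFin x) x≢root) (bounded qp))) qp)

  tree-connected : ∀ u v → WalkWithin (Edge tree) (λ _ → ⊤) u v
  tree-connected u v = to-root u ++ʷ reverseʷ tree-sym (to-root v)
    where
    to-root : ∀ x → WalkWithin (Edge tree) (λ _ → ⊤) x root
    to-root x = ascend (λ _ → ⊤) root below-root (λ _ _ → tt) tt
      where
      below-root : ∀ {y} → ⊤ → rank y ≤ rank root
      below-root {y} _ with y ≟ root
      ... | yes refl   = ℕ.≤-refl
      ... | no y≢root = ℕ.<⇒≤ (rank<root (∈-allFin y) y≢root)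

  isTree : IsTree tree
  isTree = (λ _ _ → tree-sym) , tree-irrefl , tree-connected , acyclic

  module _ (S? : ∀ i → Decidable (S i)) where

    top : ∀ i → ∃ (S i) → V {n}
    top i (x , _) = argmax rank x (filter (S? i) (allFin (suc n)))

    top∈ : ∀ i (x : ∃ (S i)) → S i (top i x)
    top∈ i (x , sx) = argmax-all rank sx (all-filter (S? i) (allFin (suc n)))

    ≤top : ∀ i (x : ∃ (S i)) {y} → S i y → rank y ≤ rank (top i x)
    ≤top i (x , _) {y} sy =
      All.lookup (f[xs]≤f[argmax] {f = rank} x (filter (S? i) (allFin (suc n))))
                 (∈-filter⁺ (S? i) (∈-allFin y) sy)

    climb-to-top : ∀ i (x : ∃ (S i)) {y} → S i y → y ≢ top i x → S i (parent y)
    climb-to-top i x sy y≢t =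
      climb i (∈-allFin _) (∈-allFin _) sy (top∈ i x) (λ t≡y → y≢t (sym t≡y)) (≤top i x sy)

    members-connected : ∀ i → InducedConnected tree (S i)
    members-connected i u v su sv = up-from su ++ʷ reverseʷ tree-sym (up-from sv)
      where
      up-from : ∀ {x} → S i x → WalkWithin (Edge tree) (S i) x (top i (u , su))
      up-from = ascend (S i) (top i (u , su)) (≤top i (u , su)) (climb-to-top i (u , su))

    -- The member whose top is lowest: climbing from a common vertex towards its top stays inside
    -- every other member, whose tops are at least as high.
    helly : (∀ i → ∃ (S i)) → ∀ Fs → (∀ {c d} → c ∈ Fs → d ∈ Fs → ∃ λ x → S c x × S d x) →
            ∃ λ x → All (λ c → S c x) Fs
    helly nonempty []        _        = root , []
    helly nonempty (c₀ ∷ Fs) pairwise = t , All.tabulate in-member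
      where
      height : I → ℕ
      height c = rank (top c (nonempty c))

      c* = argmin height c₀ (c₀ ∷ Fs)
      t  = top c* (nonempty c*)

      c*∈ : c* ∈ c₀ ∷ Fs
      c*∈ = argmin-all height {P = _∈ c₀ ∷ Fs} (here refl) (All.tabulate id)

      in-member : ∀ {c} → c ∈ c₀ ∷ Fs → S c t
      in-member {c} c∈ = proj₂ (end∈ (ascend Both t (≤top c* (nonempty c*) ∘ proj₁) up (proj₂ meet)))
        where
        meet = pairwise c*∈ c∈
        Both = λ x → S c* x × S c x

        up : ∀ {x} → Both x → x ≢ t → Both (parent x)
        up {x} (sx* , sx) x≢t =
          let sp*   = climb-to-top c* (nonempty c*) sx* x≢t
              x≢root = below≢root (≤top c* (nonempty c*) sx*) x≢t
              rx<rt = ℕ.<-≤-trans (rank<parent (∈-allFin x) x≢root) (≤top c* (nonempty c*) sp*)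
              rx<rc = ℕ.<-≤-trans rx<rt (All.lookup (f[argmin]≤f[xs] {f = height} c₀ (c₀ ∷ Fs)) c∈)
          in sp* , climb c (∈-allFin _) (∈-allFin _) sx (top∈ c (nonempty c))
                         (ℕ.<⇒≢ rx<rc ∘ sym ∘ cong rank) (ℕ.<⇒≤ rx<rc)

module ClosedWalks {n : ℕ} (R : Digraph n) where

  private
    Arc = Edge R

  toDWalk : ∀ {S : V {n} → Set} {u w} → WalkWithin Arc S u w → DWalk R u w
  toDWalk (here _)     = []
  toDWalk (step _ e p) = e ∷ toDWalk p

  module _ {S : V {n} → Set} where

    on-toDWalk⁻ : ∀ {u w x} (p : WalkWithin Arc S u w) → OnWalk x (toDWalk p) → S x
    on-toDWalk⁻ (here su)     (now refl) = su
    on-toDWalk⁻ (step su _ _) (now refl) = su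
    on-toDWalk⁻ (step _ _ p)  (later x∈) = on-toDWalk⁻ p x∈

    on-start : ∀ {u w} (p : WalkWithin Arc S u w) → OnWalk u (toDWalk p)
    on-start (here _)     = now refl
    on-start (step _ _ _) = now refl

    on-end : ∀ {u w} (p : WalkWithin Arc S u w) → OnWalk w (toDWalk p)
    on-end (here _)     = now refl
    on-end (step _ _ p) = later (on-end p)

    on-++ˡ : ∀ {u v w x} (p : WalkWithin Arc S u v) (q : WalkWithin Arc S v w) →
             OnWalk x (toDWalk p) → OnWalk x (toDWalk (p ++ʷ q))
    on-++ˡ (here _)     q (now refl) = on-start q
    on-++ˡ (step _ _ p) q (now refl) = now refl
    on-++ˡ (step _ _ p) q (later x∈) = later (on-++ˡ p q x∈)

    on-++ʳ : ∀ {u v w x} (p : WalkWithin Arc S u v) (q : WalkWithin Arc S v w) →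
             OnWalk x (toDWalk q) → OnWalk x (toDWalk (p ++ʷ q))
    on-++ʳ (here _)     q x∈ = x∈
    on-++ʳ (step _ _ p) q x∈ = later (on-++ʳ p q x∈)

    -- The first arc of p makes the closed walk p ++ q nontrivial.
    closedWalk-from : ∀ {v w} → v ≢ w → WalkWithin Arc S v w → (q : WalkWithin Arc S w v) →
                  Σ (ClosedWalk R) λ c → (∀ {x} → VerticesOf c x → S x) × VerticesOf c v ×
                                         (∀ {x} → OnWalk x (toDWalk q) → VerticesOf c x)
    closedWalk-from v≢w (here _)         q = ⊥-elim (v≢w refl)
    closedWalk-from v≢w (step sv e p) q =
      closedWalk _ _ e (toDWalk (p ++ʷ q)) , on-toDWalk⁻ (step sv e (p ++ʷ q)) , now refl ,
      later ∘ on-++ʳ p q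

  onWalk? : ∀ {u w} x (p : DWalk R u w) → Dec (OnWalk x p)
  onWalk? {u} x []      = map′ now (λ { (now x≡u) → x≡u }) (x ≟ u)
  onWalk? {u} x (e ∷ p) with x ≟ u | onWalk? x p
  ... | yes x≡u | _      = yes (now x≡u)
  ... | no _    | yes x∈ = yes (later x∈)
  ... | no x≢u  | no x∉  = no λ { (now x≡u) → x≢u x≡u ; (later x∈) → x∉ x∈ }

  nonempty : (c : ClosedWalk R) → ∃ (VerticesOf c)
  nonempty (closedWalk b _ _ _) = b , now refl

  verticesOf? : (c : ClosedWalk R) → Decidable (VerticesOf c)
  verticesOf? (closedWalk _ _ e p) x = onWalk? x (e ∷ p)

  walk-along : ∀ {u w} (p : DWalk R u w) → WalkWithin Arc (λ x → OnWalk x p) u w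
  walk-along []      = here (now refl)
  walk-along (e ∷ p) = step (now refl) e (mapʷ later (walk-along p))

  walk-from : ∀ {u w y} (p : DWalk R u w) → OnWalk y p → WalkWithin Arc (λ x → OnWalk x p) y w
  walk-from p       (now refl) = walk-along p
  walk-from (e ∷ p) (later y∈) = mapʷ later (walk-from p y∈)

  walk-to : ∀ {u w z} (p : DWalk R u w) → OnWalk z p → WalkWithin Arc (λ x → OnWalk x p) u z
  walk-to p       (now refl) = here (now refl)
  walk-to (e ∷ p) (later z∈) = step (now refl) e (mapʷ later (walk-to p z∈))

  walk-around : (c : ClosedWalk R) → ∀ {y z} → VerticesOf c y → VerticesOf c z →
                WalkWithin Arc (VerticesOf c) y z
  walk-around (closedWalk _ _ e p) y∈ z∈ = walk-from (e ∷ p) y∈ ++ʷ walk-to (e ∷ p) z∈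

  Avoiding : V {n} → V → V → Set
  Avoiding a = WalkWithin Arc (_≢ a)

  StronglyConnected : V {n} → V → V → Set
  StronglyConnected a y z = Avoiding a y z × Avoiding a z y

  stronglyConnected? : ∀ a y z → Dec (StronglyConnected a y z)
  stronglyConnected? a y z = reachable? y z ×-dec reachable? z y
    where open Reachability R (λ x → ¬? (x ≟ a))

  sc-trans : ∀ {a x y z} → StronglyConnected a x y → StronglyConnected a y z → StronglyConnected a x z
  sc-trans (xy , yx) (yz , zy) = xy ++ʷ yz , zy ++ʷ yx

  sc-around : ∀ {a} (c : ClosedWalk R) → ¬ VerticesOf c a → ∀ {y z} →
              VerticesOf c y → VerticesOf c z → StronglyConnected a y z
  sc-around c a∉c y∈ z∈ = avoid (walk-around c y∈ z∈) , avoid (walk-around c z∈ y∈)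
    where
    avoid = mapʷ λ x∈c x≡a → a∉c (subst (VerticesOf c) x≡a x∈c)

  closedWalk-avoiding : ∀ {a y z} → y ≢ z → StronglyConnected a y z →
                   Σ (ClosedWalk R) λ c → ¬ VerticesOf c a × VerticesOf c y × VerticesOf c z
  closedWalk-avoiding y≢z (yz , zy) =
    let c , ⊆avoid , y∈ , ⊇zy = closedWalk-from y≢z yz zy in
    c , (λ a∈ → ⊆avoid a∈ refl) , y∈ , ⊇zy (on-start zy)

  open Rankings {I = ClosedWalk R} VerticesOf

  MeetIn : List (V {n}) → ClosedWalk R → ClosedWalk R → Set
  MeetIn A c d = ∃ λ x → x ∈ A × VerticesOf c x × VerticesOf d x

  HellyOn : List (V {n}) → Set
  HellyOn A = ∀ Fs → (∀ {c d} → c ∈ Fs → d ∈ Fs → MeetIn A c d) →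
              ∃ λ x → x ∈ A × All (λ c → VerticesOf c x) Fs

  module Component {A a v₀ w₀} (helly : HellyOn A) (a∈A : a ∈ A) (v₀∈A : v₀ ∈ A) (w₀∈A : w₀ ∈ A)
                   (v₀≢w₀ : v₀ ≢ w₀) (v₀w₀ : StronglyConnected a v₀ w₀) where

    B : List (V {n})
    B = filter (stronglyConnected? a v₀) A

    ∈B⁺ : ∀ {x} → x ∈ A → StronglyConnected a v₀ x → x ∈ B
    ∈B⁺ = ∈-filter⁺ (stronglyConnected? a v₀)

    ∈B⁻ : ∀ {x} → x ∈ B → x ∈ A × StronglyConnected a v₀ x
    ∈B⁻ = ∈-filter⁻ (stronglyConnected? a v₀) {xs = A}

    v₀≢a : v₀ ≢ a
    v₀≢a = start∈ (proj₁ v₀w₀)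

    a∉B : a ∉ B
    a∉B a∈B = end∈ (proj₁ (proj₂ (∈B⁻ a∈B))) refl

    B-shorter : length B < length A
    B-shorter = filter-notAll (stronglyConnected? a v₀) A (Any.map (λ { refl → a∉B ∘ ∈B⁺ a∈A }) a∈A)

    v₀∈B : v₀ ∈ B
    v₀∈B = ∈B⁺ v₀∈A (here v₀≢a , here v₀≢a)

    w₀∈B : w₀ ∈ B
    w₀∈B = ∈B⁺ w₀∈A v₀w₀

    tour : ∀ Ys → All (StronglyConnected a v₀) Ys →
           Σ (Avoiding a v₀ v₀) λ p → All (λ y → OnWalk y (toDWalk p)) Ys
    tour []       []              = here v₀≢a , []
    tour (y ∷ Ys) ((p , q) ∷ scs) =
      let l , on-l = tour Ys scs in
      (p ++ʷ q) ++ʷ l ,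
      on-++ˡ (p ++ʷ q) l (on-++ˡ p q (on-end p)) ∷ All.map (on-++ʳ (p ++ʷ q) l) on-l

    private
      loop = tour B (all-filter (stronglyConnected? a v₀) A)
      hub-walk = closedWalk-from v₀≢w₀ (proj₁ v₀w₀) (proj₂ v₀w₀ ++ʷ proj₁ loop)

    hub : ClosedWalk R
    hub = proj₁ hub-walk

    a∉hub : ¬ VerticesOf hub a
    a∉hub a∈hub = proj₁ (proj₂ hub-walk) a∈hub refl

    v₀∈hub : VerticesOf hub v₀
    v₀∈hub = proj₁ (proj₂ (proj₂ hub-walk))

    B⊆hub : ∀ {x} → x ∈ B → VerticesOf hub x
    B⊆hub x∈B =
      proj₂ (proj₂ (proj₂ hub-walk)) (on-++ʳ (proj₂ v₀w₀) (proj₁ loop) (All.lookup (proj₂ loop) x∈B))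

    stays-in-B : ∀ (c : ClosedWalk R) → ¬ VerticesOf c a → ∀ {x y} →
                 y ∈ B → VerticesOf c y → x ∈ A → VerticesOf c x → x ∈ B
    stays-in-B c a∉c y∈B y∈c x∈A x∈c = ∈B⁺ x∈A (sc-trans (proj₂ (∈B⁻ y∈B)) (sc-around c a∉c y∈c x∈c))

    MeetsB : ClosedWalk R → Set
    MeetsB c = ∃ λ y → y ∈ B × VerticesOf c y

    with-hub : ∀ {Fs} → (∀ {c} → c ∈ Fs → MeetsB c) → (∀ {c d} → c ∈ Fs → d ∈ Fs → MeetIn A c d) →
               ∀ {c d} → c ∈ hub ∷ Fs → d ∈ hub ∷ Fs → MeetIn A c d
    with-hub meets pairwise (here refl) (here refl) = v₀ , v₀∈A , v₀∈hub , v₀∈hub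
    with-hub meets pairwise (here refl) (there d∈)  = let y , y∈B , y∈d = meets d∈ in
                                                      y , proj₁ (∈B⁻ y∈B) , B⊆hub y∈B , y∈d
    with-hub meets pairwise (there c∈)  (here refl) = let y , y∈B , y∈c = meets c∈ in
                                                      y , proj₁ (∈B⁻ y∈B) , y∈c , B⊆hub y∈B
    with-hub meets pairwise (there c∈)  (there d∈)  = pairwise c∈ d∈

    helly-with-hub : ∀ Fs → (∀ {c} → c ∈ Fs → MeetsB c) → (∀ {c d} → c ∈ Fs → d ∈ Fs → MeetIn A c d) →
                     ∃ λ x → x ∈ B × All (λ c → VerticesOf c x) Fs
    helly-with-hub Fs meets pairwise =
      let x , x∈A , x∈all = helly (hub ∷ Fs) (with-hub meets pairwise) in
      x , stays-in-B hub a∉hub v₀∈B v₀∈hub x∈A (All.head x∈all) , All.tail x∈all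

    helly-B : HellyOn B
    helly-B Fs pairwise =
      helly-with-hub Fs (λ c∈ → let y , y∈B , y∈c , _ = pairwise c∈ c∈ in y , y∈B , y∈c)
                        (λ c∈ d∈ → let x , x∈B , cx , dx = pairwise c∈ d∈ in x , proj₁ (∈B⁻ x∈B) , cx , dx)

    Separator : V {n} → Set
    Separator β = ∀ c → MeetsB c → ∀ {z} → z ∈ A → z ∉ B → VerticesOf c z → VerticesOf c β

    Bypass : V {n} → Set
    Bypass β = Any (λ y → Any (λ z → z ∉ B × StronglyConnected β y z) A) B

    bypass? : Decidable Bypass
    bypass? β = Any.any? (λ y → Any.any? (λ z → ¬? (z ∈? B) ×-dec stronglyConnected? β y z) A) B

    no-bypass⇒separator : ∀ {β} → ¬ Bypass β → Separator β
    no-bypass⇒separator {β} none c (y , y∈B , y∈c) z∈A z∉B z∈c with verticesOf? c β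
    ... | yes β∈c = β∈c
    ... | no β∉c  = ⊥-elim (none (lose y∈B (lose z∈A (z∉B , sc-around c β∉c y∈c z∈c))))

    -- A bypass around β yields a closed walk avoiding β that leaves B, so it must pass through a.
    bypass⇒closedWalk : ∀ {β} → Bypass β →
                   Σ (ClosedWalk R) λ c → VerticesOf c a × ¬ VerticesOf c β × MeetsB c
    bypass⇒closedWalk bypass with find bypass
    ... | y , y∈B , inner with find inner
    ...   | z , z∈A , z∉B , yz =
      let c , β∉c , y∈c , z∈c = closedWalk-avoiding (λ { refl → z∉B y∈B }) yz in
      c , a∈c c β∉c y∈c z∈c , β∉c , y , y∈B , y∈c
      where
      a∈c : ∀ c {β} → ¬ VerticesOf c β → VerticesOf c y → VerticesOf c z → VerticesOf c a
      a∈c c _ y∈c z∈c with verticesOf? c a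
      ... | yes a∈c = a∈c
      ... | no a∉c  = ⊥-elim (z∉B (stays-in-B c a∉c y∈B y∈c z∈A z∈c))

    -- If every β ∈ B had a bypass, the bypass walks together with the hub would be pairwise
    -- meeting (at a, resp. in B) without a common vertex.
    separator : ∃ λ β → β ∈ B × Separator β
    separator with All.all? bypass? B
    ... | no ¬all = let β , β∈B , none = find (¬All⇒Any¬ bypass? B ¬all) in
                    β , β∈B , no-bypass⇒separator none
    ... | yes all =
      let Fs , from , to = choose B (All.map bypass⇒closedWalk all)
          a∈ : ∀ {c} → c ∈ Fs → VerticesOf c a
          a∈ c∈ = let _ , _ , a∈c , _ = from c∈ in a∈c
          x , x∈B , x∈Fs = helly-with-hub Fs (λ c∈ → let _ , _ , _ , _ , meets = from c∈ in meets)
                                             (λ c∈ d∈ → a , a∈A , a∈ c∈ , a∈ d∈)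
          c , c∈Fs , _ , x∉c , _ = to x∈B in
      ⊥-elim (x∉c (All.lookup x∈Fs c∈Fs))

    lift-leaf : ∀ {β v u} → β ∈ B → Separator β → Leaf B v u → v ≢ β → Leaf A v u
    lift-leaf {β} β∈B sep leaf v≢β = record
      { leaf∈       = proj₁ (∈B⁻ leaf∈)
      ; attach∈     = proj₁ (∈B⁻ attach∈)
      ; attach≢leaf = attach≢leaf
      ; through     = through′
      }
      where
      open Leaf leaf
      through′ : ∀ c → VerticesOf c _ → ∀ {w} → w ∈ A → w ≢ _ → VerticesOf c w → VerticesOf c _
      through′ c v∈c {w} w∈A w≢v w∈c with w ∈? B
      ... | yes w∈B = through c v∈c w∈B w≢v w∈c
      ... | no w∉B  = through c v∈c β∈B (λ β≡v → v≢β (sym β≡v)) (sep c (_ , leaf∈ , v∈c) w∈A w∉B w∈c)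

  leaf-attached-at : ∀ {A a b} → a ∈ A → b ∈ A → b ≢ a →
                     ¬ Any (λ v → Any (λ w → v ≢ w × StronglyConnected a v w) A) A → Leaf A b a
  leaf-attached-at {a = a} a∈A b∈A b≢a none = record
    { leaf∈       = b∈A
    ; attach∈     = a∈A
    ; attach≢leaf = λ a≡b → b≢a (sym a≡b)
    ; through     = through
    }
    where
    through : ∀ c → VerticesOf c _ → ∀ {w} → _ → _ → VerticesOf c w → VerticesOf c a
    through c b∈c w∈A w≢b w∈c with verticesOf? c a
    ... | yes a∈c = a∈c
    ... | no a∉c  = ⊥-elim (none (lose b∈A (lose w∈A ((λ b≡w → w≢b (sym b≡w)) , sc-around c a∉c b∈c w∈c))))

  leaf-avoiding : ∀ {A} → Acc (_<_ on length) A → HellyOn A → ∀ {a b} → a ∈ A → b ∈ A → b ≢ a →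
                  ∃₂ λ v u → v ≢ a × Leaf A v u
  leaf-avoiding {A} (acc rs) helly {a} {b} a∈A b∈A b≢a
    with Any.any? (λ v → Any.any? (λ w → ¬? (v ≟ w) ×-dec stronglyConnected? a v w) A) A
  ... | no none = b , a , b≢a , leaf-attached-at a∈A b∈A b≢a none
  ... | yes some =
    let v₀ , v₀∈A , inner = find some
        w₀ , w₀∈A , v₀≢w₀ , v₀w₀ = find inner
        open Component helly a∈A v₀∈A w₀∈A v₀≢w₀ v₀w₀
        β , β∈B , sep = separator
        b′ , b′∈B , b′≢β = other β v₀∈B w₀∈B v₀≢w₀
        v , u , v≢β , leaf = leaf-avoiding (rs B-shorter) helly-B β∈B b′∈B b′≢β
    in v , u , (λ v≡a → a∉B (subst (_∈ B) v≡a (Leaf.leaf∈ leaf))) , lift-leaf β∈B sep leaf v≢β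
    where
    other : ∀ {B : List (V {n})} β {v w} → v ∈ B → w ∈ B → v ≢ w → ∃ λ b → b ∈ B × b ≢ β
    other β {v} {w} v∈ w∈ v≢w with v ≟ β
    ... | yes refl = w , w∈ , λ w≡v → v≢w (sym w≡v)
    ... | no v≢β   = v , v∈ , v≢β

  helly-∖ : ∀ {A v u} → HellyOn A → Leaf A v u → HellyOn (A ∖ v)
  helly-∖ {A} {v} {u} helly leaf Fs pairwise
    with helly Fs (λ c∈ d∈ → let x , x∈ , cx , dx = pairwise c∈ d∈ in x , proj₁ (∈-∖⁻ A x∈) , cx , dx)
  ... | x , x∈A , x∈Fs with x ≟ v
  ...   | no x≢v   = x , ∈-∖⁺ x∈A x≢v , x∈Fs
  ...   | yes refl = u , ∈-∖⁺ attach∈ attach≢leaf , All.tabulate λ c∈ →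
            let w , w∈ , w∈c , _ = pairwise c∈ c∈
                w∈A , w≢v = ∈-∖⁻ A w∈ in
            through _ (All.lookup x∈Fs c∈) w∈A w≢v w∈c
    where open Leaf leaf

  walkHelly⇒ranking : WalkHelly R → Ranking (allFin (suc n))
  walkHelly⇒ranking walkHelly = ranking-by-leaves HellyOn leaf helly-all (∈-allFin zero)
    where
    helly-all : HellyOn (allFin (suc n))
    helly-all Fs pairwise =
      let x , x∈Fs = walkHelly Fs (λ c d c∈ d∈ → let x , _ , cx , dx = pairwise c∈ d∈ in x , cx , dx) in
      x , ∈-allFin x , x∈Fs
    leaf : ∀ {A a b} → HellyOn A → a ∈ A → b ∈ A → b ≢ a → ∃₂ λ v u → Leaf A v u × HellyOn (A ∖ v)
    leaf helly a∈A b∈A b≢a =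
      let v , u , _ , lf = leaf-avoiding (shorter-wellFounded _) helly a∈A b∈A b≢a in
      v , u , lf , helly-∖ helly lf

module Subtrees {n : ℕ} (T : Graph n) (isTree : IsTree T) where

  private
    E = Edge T

  tree-sym : ∀ {a b} → E a b → E b a
  tree-sym = proj₁ isTree _ _

  tree-irrefl : ∀ a → E a a → ⊥
  tree-irrefl = proj₁ (proj₂ isTree)

  tree-connected : ∀ a b → WalkWithin E (λ _ → ⊤) a b
  tree-connected = proj₁ (proj₂ (proj₂ isTree))

  tree-acyclic : Cycle T → ⊥
  tree-acyclic = proj₂ (proj₂ (proj₂ isTree))

  chord⇒cycle : ∀ x y L {z} → Unique (x ∷ y ∷ L) → IsPath T (x ∷ y ∷ L) → z ∈ L → E x z → Cycle T
  chord⇒cycle x y L {z} unique path z∈L xz with ∈-∃++ z∈L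
  ... | pre , post , refl =
    close pre (unique-cut (x ∷ y ∷ pre) unique) (path-cut T (x ∷ y ∷ pre) path (tree-sym xz))
    where
    close : ∀ pre → Unique (x ∷ y ∷ pre ∷ʳ z) → IsPath T (x ∷ y ∷ pre ∷ʳ z ∷ʳ x) → Cycle T
    close []        u p = x , y , z , [] , u , p
    close (w ∷ pre) u p = x , y , w , pre ∷ʳ z , u , p

  -- In a tree this says that T[A] is connected: an excursion from A through vertices outside A
  -- returns to the vertex it left from.
  Convex : List (V {n}) → Set
  Convex A = ∀ {s t s′ t′} → s ∈ A → t ∈ A → E s s′ → E t′ t → WalkWithin E (_∉ A) s′ t′ → s ≡ t

  convex-all : Convex (allFin (suc n))
  convex-all _ _ _ _ p = ⊥-elim (start∈ p (∈-allFin _))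

  module Shortcut {A} (convex : Convex A) {Q : V {n} → Set} where

    mutual
      shortcut : ∀ {s t} → WalkWithin E Q s t → s ∈ A → t ∈ A → WalkWithin E (λ z → z ∈ A × Q z) s t
      shortcut (here qs)             s∈A t∈A = here (s∈A , qs)
      shortcut (step {v = y} qs e p) s∈A t∈A with y ∈? A
      ... | yes y∈A = step (s∈A , qs) e (shortcut p y∈A t∈A)
      ... | no y∉A  = excursion p t∈A s∈A qs e (here y∉A)

      excursion : ∀ {y t s s′} → WalkWithin E Q y t → t ∈ A → s ∈ A → Q s → E s s′ →
                  WalkWithin E (_∉ A) s′ y → WalkWithin E (λ z → z ∈ A × Q z) s t
      excursion (here _)               t∈A s∈A qs ss′ out = ⊥-elim (end∈ out t∈A)
      excursion (step {v = y′} _ e p) t∈A s∈A qs ss′ out with y′ ∈? A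
      ... | yes y′∈A = subst (λ s → WalkWithin E _ s _) (sym (convex s∈A y′∈A ss′ e out))
                             (shortcut p y′∈A t∈A)
      ... | no y′∉A  = excursion p t∈A s∈A qs ss′ (snocʷ out e y′∉A)

  open Shortcut public

  record Pendant (A : List (V {n})) (v u : V) : Set where
    field
      pendant∈         : v ∈ A
      neighbour∈       : u ∈ A
      neighbour≢       : u ≢ v
      unique-neighbour : ∀ {z} → z ∈ A → E v z → z ≡ u

  module _ {I : Set} {S : I → V {n} → Set} where
    open Rankings S

    pendant⇒leaf : ∀ {A v u} → Convex A → (∀ i → InducedConnected T (S i)) → Pendant A v u → Leaf A v u
    pendant⇒leaf {A} {v} {u} convex connected pendant = record
      { leaf∈ = pendant∈ ; attach∈ = neighbour∈ ; attach≢leaf = neighbour≢ ; through = through }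
      where
      open Pendant pendant
      through : ∀ i → S i v → ∀ {w} → w ∈ A → w ≢ v → S i w → S i u
      through i sv w∈A w≢v sw with shortcut convex (connected i v _ sv sw) pendant∈ w∈A
      ... | here _     = ⊥-elim (w≢v refl)
      ... | step _ e p = let y∈A , sy = start∈ p in subst (S i) (unique-neighbour y∈A e) sy

  module _ {A v u} (convex : Convex A) (pendant : Pendant A v u) where
    open Pendant pendant

    outside : ∀ {x} → x ∉ A ∖ v × x ≢ v → x ∉ A
    outside (x∉ , x≢v) x∈A = x∉ (∈-∖⁺ x∈A x≢v)

    leaves-from-u : ∀ {s s′ t′} → s ∈ A ∖ v → E s s′ → WalkWithin E (_∉ A ∖ v) s′ t′ →
                    s ≡ u ⊎ WalkWithin E (_∉ A) s′ t′
    leaves-from-u {s} s∈ ss′ p with ∈-∖⁻ A s∈ | first-visit v p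
    ... | _   , _   | inj₁ p′                   = inj₂ (mapʷ outside p′)
    ... | s∈A , _   | inj₂ (inj₁ refl)          = inj₁ (unique-neighbour s∈A (tree-sym ss′))
    ... | s∈A , s≢v | inj₂ (inj₂ (z , p′ , zv)) =
      ⊥-elim (s≢v (convex s∈A pendant∈ ss′ zv (mapʷ outside p′)))

    convex-∖ : Convex (A ∖ v)
    convex-∖ {s} {t} s∈ t∈ ss′ t′t p with leaves-from-u s∈ ss′ p
    ... | inj₂ p′  = convex (proj₁ (∈-∖⁻ A s∈)) (proj₁ (∈-∖⁻ A t∈)) ss′ t′t p′
    ... | inj₁ s≡u with leaves-from-u t∈ (tree-sym t′t) (reverseʷ tree-sym p)
    ...   | inj₁ t≡u = trans s≡u (sym t≡u)
    ...   | inj₂ p′  = convex (proj₁ (∈-∖⁻ A s∈)) (proj₁ (∈-∖⁻ A t∈)) ss′ t′t (reverseʷ tree-sym p′)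


  module _ {A} (convex : Convex A) where

    neighbour-in : ∀ {a b} → a ∈ A → b ∈ A → b ≢ a → ∃ λ z → z ∈ A × E a z
    neighbour-in a∈A b∈A b≢a with shortcut convex {Q = λ _ → ⊤} (tree-connected _ _) a∈A b∈A
    ... | here _     = ⊥-elim (b≢a refl)
    ... | step _ e p = _ , proj₁ (start∈ p) , e

    -- Depth-first search along a path e, q, … of T[A], newest vertex first; U contains the vertices
    -- of A not on the path. When stuck, any neighbour of e in A other than q would close a cycle.
    search : ∀ e q rest U → Acc (_<_ on length) U → (∀ {x} → x ∈ A → x ∉ e ∷ q ∷ rest → x ∈ U) →
             Unique (e ∷ q ∷ rest) → IsPath T (e ∷ q ∷ rest) → All (_∈ A) (e ∷ q ∷ rest) → ∃₂ (Pendant A)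
    search e q rest U (acc rs) unvisited unique path in-A
      with Any.any? (λ z → edge? T e z ×-dec ¬? (z ∈? (e ∷ q ∷ rest))) A
    ... | yes new =
      let z , z∈A , ez , z∉ = find new in
      search z e (q ∷ rest) (U ∖ z) (rs (∖-shorter (unvisited z∈A z∉)))
             (λ x∈A x∉ → ∈-∖⁺ (unvisited x∈A (x∉ ∘ there)) (x∉ ∘ here))
             (¬Any⇒All¬ _ z∉ ∷ unique) (tree-sym ez , path) (z∈A ∷ in-A)
    ... | no none = e , q , record
      { pendant∈         = All.head in-A
      ; neighbour∈       = All.head (All.tail in-A)
      ; neighbour≢       = λ q≡e → All.head (AllPairs.head unique) (sym q≡e)
      ; unique-neighbour = only-q
      }
      where
      only-q : ∀ {z} → z ∈ A → E e z → z ≡ q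
      only-q z∈A ez with _ ∈? (e ∷ q ∷ rest)
      ... | no z∉                  = ⊥-elim (none (lose z∈A (ez , z∉)))
      ... | yes (here refl)         = ⊥-elim (tree-irrefl _ ez)
      ... | yes (there (here refl)) = refl
      ... | yes (there (there z∈))  = ⊥-elim (tree-acyclic (chord⇒cycle e q rest unique path z∈ ez))

    pendant-exists : ∀ {a b} → a ∈ A → b ∈ A → b ≢ a → ∃₂ (Pendant A)
    pendant-exists {a} a∈A b∈A b≢a =
      let z , z∈A , az = neighbour-in a∈A b∈A b≢a in
      search z a [] (allFin (suc n)) (shorter-wellFounded _) (λ _ _ → ∈-allFin _)
             (((λ z≡a → tree-irrefl a (subst (E a) z≡a az)) ∷ []) ∷ [] ∷ [])
             (tree-sym az , tt) (z∈A ∷ a∈A ∷ [])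

  subtree-ranking : ∀ {I} {S : I → V {n} → Set} → (∀ i → InducedConnected T (S i)) →
                    Rankings.Ranking S (allFin (suc n))
  subtree-ranking {S = S} connected = ranking-by-leaves Convex leaf convex-all (∈-allFin zero)
    where
    open Rankings S
    leaf : ∀ {A a b} → Convex A → a ∈ A → b ∈ A → b ≢ a → ∃₂ λ v u → Leaf A v u × Convex (A ∖ v)
    leaf convex a∈A b∈A b≢a =
      let v , u , pendant = pendant-exists convex a∈A b∈A b≢a in
      v , u , pendant⇒leaf convex connected pendant , convex-∖ convex pendant

proposition4p12 : (n : ℕ) (R : Digraph n) → ConnectedDigraph R →
    (WalkHelly R → TreeRepresentation R) × (TreeRepresentation R → WalkHelly R)
proposition4p12 n R _ = helly⇒representation , representation⇒helly
  where
  open ClosedWalks R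

  helly⇒representation : WalkHelly R → TreeRepresentation R
  helly⇒representation walkHelly =
    let open ParentTree (walkHelly⇒ranking walkHelly) in
    tree , isTree , members-connected verticesOf?

  representation⇒helly : TreeRepresentation R → WalkHelly R
  representation⇒helly (T , isTree , connected) Fs pairwise =
    let open ParentTree (Subtrees.subtree-ranking T isTree connected) in
    helly verticesOf? nonempty Fs (pairwise _ _)
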